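{- For every positive integer $N$ there exist an integer $n\ge N$ and a 2-comparable set of triples with all coordinates in $[n]=\{1,\dots,n\}$ of size at least $n^{1.546}$.
   Context: For integer triples $a=(a_1,a_2,a_3)$ and $b=(b_1,b_2,b_3)$, write $a<_2b$ if $a_i<b_i$ for at least two indices $i\in\{1,2,3\}$. Two triples are 2-comparable if one of them is 2-less than the other; a set of triples is 2-comparable if any two distinct elements of it are 2-comparable. -}

module Defs where

open import Data.Nat using (ℕ; _<_; _≤_; _^_)
open import Data.Product using (_×_; _,_)
open import Data.Sum using (_⊎_)
open import Data.List using (List; length)
open import Data.List.Relation.Unary.All using (All)
open import Data.List.Relation.Unary.Unique.Propositional using (Unique)
open import Relation.Binary.PropositionalEquality using (_≡_)
open import Relation.Nullary using (¬_)

-- integer triples (coordinates lie in [n] ⊆ ℕ, so ℕ suffices)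
Triple : Set
Triple = ℕ × ℕ × ℕ

_<₂_ : Triple → Triple → Set
(a₁ , a₂ , a₃) <₂ (b₁ , b₂ , b₃) =
  (a₁ < b₁ × a₂ < b₂) ⊎ (a₁ < b₁ × a₃ < b₃) ⊎ (a₂ < b₂ × a₃ < b₃)

2-comparable : Triple → Triple → Set
2-comparable a b = a <₂ b ⊎ b <₂ a

-- a set of triples (a duplicate-free list) is 2-comparable if any two
-- distinct elements are 2-comparable
2-comparableSet : List Triple → Set
2-comparableSet S = ∀ a b → a ∈ S → b ∈ S → ¬ (a ≡ b) → 2-comparable a b
  where open import Data.List.Membership.Propositional using (_∈_)

In[_] : ℕ → ℕ → Set
In[ n ] x = 1 ≤ x × x ≤ n

TripleIn[_] : ℕ → Triple → Set
TripleIn[ n ] (x , y , z) = In[ n ] x × In[ n ] y × In[ n ] z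

-- A letter map π sends each of five letters to one of the pairwise 2-comparable points
-- (2,2,2), (0,0,0), (2,1,0), (1,0,2), (0,2,1) of {0,1,2}³.  A word w over these letters thus gives three
-- words π₁w, π₂w, π₃w over {0,1,2}, and w is coded by the triple of their lexicographic ranks.  Two
-- distinct words with the same letter multiplicities first differ in two distinct letters, which are
-- 2-comparable, so two of the three ranks compare in the same direction: the codes form a 2-comparable
-- set.  For words of length 25996 with suitable multiplicities there are at least 2^59152 codes, while
-- each πᵢw ranges over n₀ ≤ 2^38260 words, and 59152/38260 > 1.546.  Tensor powers, combining a and b
-- into a·n′ + b coordinatewise, preserve 2-comparability and the exponent, giving arbitrarily large n.

module Submission where

open import Data.Empty using (⊥-elim)
open import Data.Fin as Fin using (Fin; zero; suc; toℕ; #_)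
import Data.Fin.Properties as Fin
open import Data.List using (List; []; _∷_; _++_; map; length; concat; tabulate; cartesianProductWith)
open import Data.List.Membership.Propositional using (_∈_)
open import Data.List.Membership.Propositional.Properties using (∈-map⁻; ∈-++⁻; ∈-concat⁻)
open import Data.List.Properties using (length-map; length-++)
open import Data.List.Relation.Unary.All as All using (All; []; _∷_)
import Data.List.Relation.Unary.All.Properties as All
open import Data.List.Relation.Unary.AllPairs as AllPairs using (AllPairs; []; _∷_)
import Data.List.Relation.Unary.AllPairs.Properties as AllPairs
open import Data.List.Relation.Unary.Any using (here; there)
open import Data.List.Relation.Unary.Any.Properties using (tabulate⁻)
open import Data.List.Relation.Unary.Unique.Propositional using (Unique)
open import Data.Nat
open import Data.Nat.DivMod using (m*n/n≡m)
open import Data.Nat.Properties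
open import Algebra.Properties.CommutativeSemigroup *-commutativeSemigroup using (x∙yz≈y∙xz)
open import Algebra.Properties.Semiring.Sum +-*-semiring
  using (sum-syntax; *-distribʳ-sum; sum-cong-≗) renaming (sum to ∑)
open import Data.Product using (Σ; ∃-syntax; _×_; _,_)
open import Data.Sum using (inj₁; inj₂)
open import Data.Unit using (tt)
open import Data.Vec using (Vec; []; _∷_; lookup; updateAt; replicate; sum)
open import Data.Vec.Properties using (lookup∘updateAt; updateAt-updateAt)
open import Function using (_∘_)
open import Relation.Binary.PropositionalEquality
open import Relation.Nullary using (Dec; ¬_)
open import Relation.Nullary.Decidable using (_×-dec_; _⊎-dec_; _→-dec_; toWitness)

open import Defs

coord : Fin 3 → Triple → ℕ
coord zero             (a , _ , _) = a
coord (suc zero)       (_ , b , _) = b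
coord (suc (suc zero)) (_ , _ , c) = c

triple : (Fin 3 → ℕ) → Triple
triple f = f zero , f (suc zero) , f (suc (suc zero))

coord-triple : ∀ f i → coord i (triple f) ≡ f i
coord-triple f zero             = refl
coord-triple f (suc zero)       = refl
coord-triple f (suc (suc zero)) = refl

_⊕_ : Triple → Triple → Triple
a ⊕ b = triple λ i → coord i a + coord i b

coord-⊕ : ∀ i a b → coord i (a ⊕ b) ≡ coord i a + coord i b
coord-⊕ i a b = coord-triple (λ j → coord j a + coord j b) i

Below : ℕ → Triple → Set
Below n t = ∀ i → coord i t < n

<₂-transfer : ∀ {a b a′ b′} → (∀ i → coord i a < coord i b → coord i a′ < coord i b′) →
              a <₂ b → a′ <₂ b′
<₂-transfer h (inj₁ (p , q))        = inj₁ (h zero p , h (suc zero) q)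
<₂-transfer h (inj₂ (inj₁ (p , q))) = inj₂ (inj₁ (h zero p , h (suc (suc zero)) q))
<₂-transfer h (inj₂ (inj₂ (p , q))) = inj₂ (inj₂ (h (suc zero) p , h (suc (suc zero)) q))

2-comparable-transfer : ∀ {a b a′ b′} →
  (∀ i → coord i a < coord i b → coord i a′ < coord i b′) →
  (∀ i → coord i b < coord i a → coord i b′ < coord i a′) →
  2-comparable a b → 2-comparable a′ b′
2-comparable-transfer h _ (inj₁ a<₂b) = inj₁ (<₂-transfer h a<₂b)
2-comparable-transfer _ h (inj₂ b<₂a) = inj₂ (<₂-transfer h b<₂a)

2-comparable-sym : ∀ {a b} → 2-comparable a b → 2-comparable b a
2-comparable-sym (inj₁ a<₂b) = inj₂ a<₂b
2-comparable-sym (inj₂ b<₂a) = inj₁ b<₂a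

<₂-irrefl : ∀ {a} → ¬ (a <₂ a)
<₂-irrefl (inj₁ (p , _))        = <-irrefl refl p
<₂-irrefl (inj₂ (inj₁ (p , _))) = <-irrefl refl p
<₂-irrefl (inj₂ (inj₂ (p , _))) = <-irrefl refl p

2-comparable⇒≢ : ∀ {a b} → 2-comparable a b → ¬ (a ≡ b)
2-comparable⇒≢ (inj₁ a<₂a) refl = <₂-irrefl a<₂a
2-comparable⇒≢ (inj₂ a<₂a) refl = <₂-irrefl a<₂a

AllPairs⇒2-comparableSet : ∀ {S} → AllPairs 2-comparable S → 2-comparableSet S
AllPairs⇒2-comparableSet (_ ∷ _)    _ _ (here refl) (here refl) a≢b = ⊥-elim (a≢b refl)
AllPairs⇒2-comparableSet (ps ∷ _)   _ _ (here refl) (there b∈) _  = All.lookup ps b∈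
AllPairs⇒2-comparableSet (ps ∷ _)   _ _ (there a∈) (here refl) _  = 2-comparable-sym (All.lookup ps a∈)
AllPairs⇒2-comparableSet (_ ∷ pss) a b (there a∈) (there b∈) a≢b =
  AllPairs⇒2-comparableSet pss a b a∈ b∈ a≢b

_<₂?_ : ∀ a b → Dec (a <₂ b)
(a₁ , a₂ , a₃) <₂? (b₁ , b₂ , b₃) =
  ((a₁ <? b₁) ×-dec (a₂ <? b₂))
    ⊎-dec (((a₁ <? b₁) ×-dec (a₃ <? b₃)) ⊎-dec ((a₂ <? b₂) ×-dec (a₃ <? b₃)))

2-comparable? : ∀ a b → Dec (2-comparable a b)
2-comparable? a b = (a <₂? b) ⊎-dec (b <₂? a)

⊕-monoʳ-< : ∀ o {a b} i → coord i a < coord i b → coord i (o ⊕ a) < coord i (o ⊕ b)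
⊕-monoʳ-< o {a} {b} i a<b rewrite coord-⊕ i o a | coord-⊕ i o b = +-monoʳ-< (coord i o) a<b

⊕-2-comparable : ∀ o {a b} → 2-comparable a b → 2-comparable (o ⊕ a) (o ⊕ b)
⊕-2-comparable o = 2-comparable-transfer (⊕-monoʳ-< o) (⊕-monoʳ-< o)

-- Tensor products

*+-<-lex : ∀ {a a′ n′} b b′ → a < a′ → b < n′ → a * n′ + b < a′ * n′ + b′
*+-<-lex {a} {a′} {n′} b b′ a<a′ b<n′ = begin-strict
  a * n′ + b   <⟨ +-monoʳ-< (a * n′) b<n′ ⟩
  a * n′ + n′  ≡⟨ +-comm (a * n′) n′ ⟩
  suc a * n′   ≤⟨ *-monoˡ-≤ n′ a<a′ ⟩
  a′ * n′      ≤⟨ m≤m+n (a′ * n′) b′ ⟩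
  a′ * n′ + b′ ∎
  where open ≤-Reasoning

scale : ℕ → Triple → Triple
scale n′ a = triple λ i → coord i a * n′

place : ℕ → Triple → Triple → Triple
place n′ a b = scale n′ a ⊕ b

coord-place : ∀ n′ a b i → coord i (place n′ a b) ≡ coord i a * n′ + coord i b
coord-place n′ a b i =
  trans (coord-⊕ i (scale n′ a) b) (cong (_+ coord i b) (coord-triple (λ j → coord j a * n′) i))

tensor : ℕ → List Triple → List Triple → List Triple
tensor n′ = cartesianProductWith (place n′)

length-tensor : ∀ n′ S S′ → length (tensor n′ S S′) ≡ length S * length S′
length-tensor n′ []      S′ = refl
length-tensor n′ (a ∷ S) S′ = begin
  length (map (place n′ a) S′ ++ tensor n′ S S′)         ≡⟨ length-++ (map (place n′ a) S′) ⟩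
  length (map (place n′ a) S′) + length (tensor n′ S S′) ≡⟨ cong₂ _+_ (length-map _ S′) (length-tensor n′ S S′) ⟩
  length S′ + length S * length S′                       ∎
  where open ≡-Reasoning

∈-tensor⁻ : ∀ n′ S S′ {t} → t ∈ tensor n′ S S′ → ∃[ a ] a ∈ S × ∃[ b ] b ∈ S′ × t ≡ place n′ a b
∈-tensor⁻ n′ (a ∷ S) S′ t∈ with ∈-++⁻ (map (place n′ a) S′) t∈
... | inj₁ t∈row with ∈-map⁻ (place n′ a) t∈row
...   | b , b∈ , refl = a , here refl , b , b∈ , refl
∈-tensor⁻ n′ (a ∷ S) S′ t∈ | inj₂ t∈rest with ∈-tensor⁻ n′ S S′ t∈rest
...   | a′ , a′∈ , rest = a′ , there a′∈ , rest

place-< : ∀ n′ {a a′ b b′} i → coord i a < coord i a′ → coord i b < n′ →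
          coord i (place n′ a b) < coord i (place n′ a′ b′)
place-< n′ {a} {a′} {b} {b′} i a<a′ b<n′ =
  subst₂ _<_ (sym (coord-place n′ a b i)) (sym (coord-place n′ a′ b′ i))
    (*+-<-lex (coord i b) (coord i b′) a<a′ b<n′)

tensor-Below : ∀ n n′ S S′ → All (Below n) S → All (Below n′) S′ → All (Below (n * n′)) (tensor n′ S S′)
tensor-Below n n′ S S′ S<n S′<n′ = All.tabulate below
  where
    below : ∀ {t} → t ∈ tensor n′ S S′ → Below (n * n′) t
    below t∈ i with ∈-tensor⁻ n′ S S′ t∈
    ... | a , a∈ , b , b∈ , refl = begin-strict
      coord i (place n′ a b)     ≡⟨ coord-place n′ a b i ⟩
      coord i a * n′ + coord i b <⟨ *+-<-lex (coord i b) 0 (All.lookup S<n a∈ i) (All.lookup S′<n′ b∈ i) ⟩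
      n * n′ + 0                 ≡⟨ +-identityʳ (n * n′) ⟩
      n * n′                     ∎
      where open ≤-Reasoning

tensor-2-comparable : ∀ n′ S S′ → AllPairs 2-comparable S → AllPairs 2-comparable S′ →
                      All (Below n′) S′ → AllPairs 2-comparable (tensor n′ S S′)
tensor-2-comparable n′ []      S′ _          _    _     = []
tensor-2-comparable n′ (a ∷ S) S′ (a~ ∷ S~) S′~ S′<n′ =
  AllPairs.++⁺ (AllPairs.map⁺ (AllPairs.map (⊕-2-comparable (scale n′ a)) S′~))
    (tensor-2-comparable n′ S S′ S~ S′~ S′<n′)
    (All.tabulate λ x∈ → All.tabulate λ y∈ → across x∈ y∈)
  where
    across : ∀ {x y} → x ∈ map (place n′ a) S′ → y ∈ tensor n′ S S′ → 2-comparable x y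
    across x∈ y∈ with ∈-map⁻ (place n′ a) x∈ | ∈-tensor⁻ n′ S S′ y∈
    ... | b , b∈ , refl | a′ , a′∈ , b′ , b′∈ , refl = 2-comparable-transfer
      (λ i a<a′ → place-< n′ i a<a′ (All.lookup S′<n′ b∈ i))
      (λ i a′<a → place-< n′ i a′<a (All.lookup S′<n′ b′∈ i))
      (All.lookup a~ a′∈)

tensorPower : ℕ → List Triple → ℕ → List Triple
tensorPower n S zero    = (0 , 0 , 0) ∷ []
tensorPower n S (suc j) = tensor (n ^ j) S (tensorPower n S j)

length-tensorPower : ∀ n S j → length (tensorPower n S j) ≡ length S ^ j
length-tensorPower n S zero    = refl
length-tensorPower n S (suc j) =
  trans (length-tensor (n ^ j) S (tensorPower n S j)) (cong (length S *_) (length-tensorPower n S j))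

tensorPower-Below : ∀ n S j → All (Below n) S → All (Below (n ^ j)) (tensorPower n S j)
tensorPower-Below n S zero    _   = (λ { zero → z<s ; (suc zero) → z<s ; (suc (suc zero)) → z<s }) ∷ []
tensorPower-Below n S (suc j) S<n =
  tensor-Below n (n ^ j) S (tensorPower n S j) S<n (tensorPower-Below n S j S<n)

tensorPower-2-comparable : ∀ n S j → All (Below n) S → AllPairs 2-comparable S →
                           AllPairs 2-comparable (tensorPower n S j)
tensorPower-2-comparable n S zero    _   _  = [] ∷ []
tensorPower-2-comparable n S (suc j) S<n S~ =
  tensor-2-comparable (n ^ j) S (tensorPower n S j) S~ (tensorPower-2-comparable n S j S<n S~)
    (tensorPower-Below n S j S<n)

-- Multinomial coefficients

ifNonZero_then_else_ : ∀ {A : Set} → ℕ → A → A → A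
ifNonZero zero    then _ else d = d
ifNonZero (suc _) then x else _ = x

decrementAt : ∀ {r} → Vec ℕ r → Fin r → Vec ℕ r
decrementAt c x = updateAt c x pred

-- For sum c ≡ K, multinomial K c counts the words of length K in which each letter x occurs
-- lookup c x times, split according to the first letter.
-- Opaque, so that the typechecker never evaluates the huge concrete instances below.
opaque
  multinomial : ∀ {r} → ℕ → Vec ℕ r → ℕ
  multinomial         zero    c = 1
  multinomial {r = r} (suc K) c =
    ∑[ x < r ] (ifNonZero lookup c x then multinomial K (decrementAt c x) else 0)

branchCount : ∀ {r} → ℕ → Vec ℕ r → Fin r → ℕ
branchCount K c x = ifNonZero lookup c x then multinomial K (decrementAt c x) else 0

opaque
  unfolding multinomial

  multinomial-zero : ∀ {r} (c : Vec ℕ r) → multinomial 0 c ≡ 1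
  multinomial-zero c = refl

  multinomial-suc : ∀ {r} K (c : Vec ℕ r) → multinomial (suc K) c ≡ ∑[ x < r ] branchCount K c x
  multinomial-suc K c = refl

branchCount-nonZero : ∀ {r} K (c : Vec ℕ r) x → 0 < lookup c x →
                      branchCount K c x ≡ multinomial K (decrementAt c x)
branchCount-nonZero K c x 0<c[x] with lookup c x
... | suc _ = refl

∏! : ∀ {r} → Vec ℕ r → ℕ
∏! []      = 1
∏! (a ∷ c) = a ! * ∏! c

∏!-nonZero : ∀ {r} (c : Vec ℕ r) → NonZero (∏! c)
∏!-nonZero []      = _
∏!-nonZero (a ∷ c) = m*n≢0 (a !) (∏! c) {{a !≢0}} {{∏!-nonZero c}}

∑-lookup : ∀ {r} (c : Vec ℕ r) → ∑[ x < r ] lookup c x ≡ sum c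
∑-lookup []      = refl
∑-lookup (a ∷ c) = cong (a +_) (∑-lookup c)

sum-decrementAt : ∀ {r} (c : Vec ℕ r) x {m} → lookup c x ≡ suc m → sum c ≡ suc (sum (decrementAt c x))
sum-decrementAt (a ∷ c) zero    refl      = refl
sum-decrementAt (a ∷ c) (suc x) c[x]≡1+m = trans (cong (a +_) (sum-decrementAt c x c[x]≡1+m)) (+-suc a _)

∏!-decrementAt : ∀ {r} (c : Vec ℕ r) x {m} → lookup c x ≡ suc m → ∏! c ≡ suc m * ∏! (decrementAt c x)
∏!-decrementAt (a ∷ c) zero    {m} refl      = *-assoc (suc m) (m !) (∏! c)
∏!-decrementAt (a ∷ c) (suc x) {m} c[x]≡1+m =
  trans (cong (a ! *_) (∏!-decrementAt c x c[x]≡1+m)) (x∙yz≈y∙xz (a !) (suc m) _)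

∏!-sum≡0 : ∀ {r} (c : Vec ℕ r) → sum c ≡ 0 → ∏! c ≡ 1
∏!-sum≡0 []         _      = refl
∏!-sum≡0 (zero ∷ c) Σc≡0 = trans (+-identityʳ (∏! c)) (∏!-sum≡0 c Σc≡0)

multinomial-*-∏! : ∀ {r} K (c : Vec ℕ r) → sum c ≡ K → multinomial K c * ∏! c ≡ K !
multinomial-*-∏!         zero    c Σc≡0   = begin
  multinomial 0 c * ∏! c ≡⟨ cong (_* ∏! c) (multinomial-zero c) ⟩
  1 * ∏! c               ≡⟨ *-identityˡ (∏! c) ⟩
  ∏! c                   ≡⟨ ∏!-sum≡0 c Σc≡0 ⟩
  1                      ∎
  where open ≡-Reasoning
multinomial-*-∏! {r = r} (suc K) c Σc≡1+K = begin
  multinomial (suc K) c * ∏! c          ≡⟨ cong (_* ∏! c) (multinomial-suc K c) ⟩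
  (∑[ x < r ] branchCount K c x) * ∏! c ≡⟨ *-distribʳ-sum (∏! c) (branchCount K c) ⟩
  ∑[ x < r ] (branchCount K c x * ∏! c) ≡⟨ sum-cong-≗ branch ⟩
  ∑[ x < r ] (lookup c x * K !)         ≡⟨ *-distribʳ-sum (K !) (lookup c) ⟨
  (∑[ x < r ] lookup c x) * K !         ≡⟨ cong (_* K !) (trans (∑-lookup c) Σc≡1+K) ⟩
  suc K * K !                           ∎
  where
    open ≡-Reasoning
    branch : ∀ x → branchCount K c x * ∏! c ≡ lookup c x * K !
    branch x with lookup c x in c[x]≡
    ... | zero  = refl
    ... | suc m = begin
      multinomial K c′ * ∏! c            ≡⟨ cong (multinomial K c′ *_) (∏!-decrementAt c x c[x]≡) ⟩
      multinomial K c′ * (suc m * ∏! c′) ≡⟨ x∙yz≈y∙xz (multinomial K c′) (suc m) (∏! c′) ⟩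
      suc m * (multinomial K c′ * ∏! c′) ≡⟨ cong (suc m *_) (multinomial-*-∏! K c′ Σc′≡K) ⟩
      suc m * K !                        ∎
      where
        c′ = decrementAt c x
        Σc′≡K : sum c′ ≡ K
        Σc′≡K = suc-injective (trans (sym (sum-decrementAt c x c[x]≡)) Σc≡1+K)

multinomial≡!/∏! : ∀ {r} K (c : Vec ℕ r) → sum c ≡ K → multinomial K c ≡ (K ! / ∏! c) {{∏!-nonZero c}}
multinomial≡!/∏! K c Σc≡K = begin
  multinomial K c                 ≡⟨ m*n/n≡m (multinomial K c) (∏! c) ⟨
  (multinomial K c * ∏! c) / ∏! c ≡⟨ cong (_/ ∏! c) (multinomial-*-∏! K c Σc≡K) ⟩
  K ! / ∏! c                      ∎
  where
    open ≡-Reasoning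
    instance _ = ∏!-nonZero c

pushforward : ∀ {r s} → (Fin r → Fin s) → Vec ℕ r → Vec ℕ s
pushforward {s = s} f []      = replicate s 0
pushforward         f (a ∷ c) = updateAt (pushforward (f ∘ suc) c) (f zero) (a +_)

lookup-updateAt-≤ : ∀ {n} {g : ℕ → ℕ} → (∀ v → v ≤ g v) → (xs : Vec ℕ n) (i j : Fin n) →
                    lookup xs j ≤ lookup (updateAt xs i g) j
lookup-updateAt-≤ g-infl (x ∷ xs) zero    zero    = g-infl x
lookup-updateAt-≤ g-infl (x ∷ xs) zero    (suc j) = ≤-refl
lookup-updateAt-≤ g-infl (x ∷ xs) (suc i) zero    = ≤-refl
lookup-updateAt-≤ g-infl (x ∷ xs) (suc i) (suc j) = lookup-updateAt-≤ g-infl xs i j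

updateAt-commutes-local : ∀ {A : Set} {n} (xs : Vec A n) (i j : Fin n) {f g : A → A} →
                          (i ≡ j → f (g (lookup xs i)) ≡ g (f (lookup xs i))) →
                          updateAt (updateAt xs j g) i f ≡ updateAt (updateAt xs i f) j g
updateAt-commutes-local (x ∷ xs) zero    zero    fg≡gf = cong (_∷ xs) (fg≡gf refl)
updateAt-commutes-local (x ∷ xs) zero    (suc j) _     = refl
updateAt-commutes-local (x ∷ xs) (suc i) zero    _     = refl
updateAt-commutes-local (x ∷ xs) (suc i) (suc j) fg≡gf =
  cong (x ∷_) (updateAt-commutes-local xs i j (fg≡gf ∘ cong suc))

lookup-pushforward-≥ : ∀ {r s} (f : Fin r → Fin s) (c : Vec ℕ r) x → lookup c x ≤ lookup (pushforward f c) (f x)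
lookup-pushforward-≥ f (a ∷ c) zero    =
  subst (a ≤_) (sym (lookup∘updateAt (f zero) (pushforward (f ∘ suc) c))) (m≤m+n a _)
lookup-pushforward-≥ f (a ∷ c) (suc x) =
  ≤-trans (lookup-pushforward-≥ (f ∘ suc) c x)
          (lookup-updateAt-≤ (λ v → m≤n+m v a) (pushforward (f ∘ suc) c) (f zero) (f (suc x)))

+-pred : ∀ a {v} → 0 < v → a + pred v ≡ pred (a + v)
+-pred a {suc v} _ = cong pred (sym (+-suc a v))

pushforward-decrementAt : ∀ {r s} (f : Fin r → Fin s) (c : Vec ℕ r) x → 0 < lookup c x →
                          pushforward f (decrementAt c x) ≡ decrementAt (pushforward f c) (f x)
pushforward-decrementAt f (suc m ∷ c) zero    _ = sym (updateAt-updateAt (f zero) (pushforward (f ∘ suc) c))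
pushforward-decrementAt f (a ∷ c)     (suc x) 0<c[x] = begin
  updateAt (pushforward (f ∘ suc) (decrementAt c x)) (f zero) (a +_)
    ≡⟨ cong (λ v → updateAt v (f zero) (a +_)) (pushforward-decrementAt (f ∘ suc) c x 0<c[x]) ⟩
  updateAt (updateAt P (f (suc x)) pred) (f zero) (a +_)
    ≡⟨ updateAt-commutes-local P (f zero) (f (suc x)) pred-commutes ⟩
  updateAt (updateAt P (f zero) (a +_)) (f (suc x)) pred ∎
  where
    open ≡-Reasoning
    P = pushforward (f ∘ suc) c
    pred-commutes : f zero ≡ f (suc x) → a + pred (lookup P (f zero)) ≡ pred (a + lookup P (f zero))
    pred-commutes same = +-pred a (subst (λ j → 0 < lookup P j) (sym same)
                                    (<-≤-trans 0<c[x] (lookup-pushforward-≥ (f ∘ suc) c x)))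

branchCount-pushforward : ∀ {r s} K (f : Fin r → Fin s) (c : Vec ℕ r) x → 0 < lookup c x →
  branchCount K (pushforward f c) (f x) ≡ multinomial K (pushforward f (decrementAt c x))
branchCount-pushforward K f c x 0<c[x] = begin
  branchCount K (pushforward f c) (f x)               ≡⟨ branchCount-nonZero K (pushforward f c) (f x) 0<fc[fx] ⟩
  multinomial K (decrementAt (pushforward f c) (f x)) ≡⟨ cong (multinomial K) (pushforward-decrementAt f c x 0<c[x]) ⟨
  multinomial K (pushforward f (decrementAt c x))     ∎
  where
    open ≡-Reasoning
    0<fc[fx] = <-≤-trans 0<c[x] (lookup-pushforward-≥ f c x)

prefixSum : ∀ {n} → (Fin n → ℕ) → Fin n → ℕ
prefixSum f zero    = 0
prefixSum f (suc v) = f zero + prefixSum (f ∘ suc) v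

prefixSum-+-≤-∑ : ∀ {n} (f : Fin n → ℕ) v → prefixSum f v + f v ≤ ∑[ u < n ] f u
prefixSum-+-≤-∑ f zero    = m≤m+n (f zero) _
prefixSum-+-≤-∑ f (suc v) =
  ≤-trans (≤-reflexive (+-assoc (f zero) _ _)) (+-monoʳ-≤ (f zero) (prefixSum-+-≤-∑ (f ∘ suc) v))

prefixSum-+-≤ : ∀ {n} (f : Fin n → ℕ) {u v} → u Fin.< v → prefixSum f u + f u ≤ prefixSum f v
prefixSum-+-≤ f {zero}  {suc v} _         = m≤m+n (f zero) _
prefixSum-+-≤ f {suc u} {suc v} (s≤s u<v) =
  ≤-trans (≤-reflexive (+-assoc (f zero) _ _)) (+-monoʳ-≤ (f zero) (prefixSum-+-≤ (f ∘ suc) u<v))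

∈-concat-tabulate⁻ : ∀ {A : Set} {n} (f : Fin n → List A) {a} → a ∈ concat (tabulate f) → ∃[ x ] a ∈ f x
∈-concat-tabulate⁻ f a∈ = tabulate⁻ (∈-concat⁻ (tabulate f) a∈)

length-concat-tabulate : ∀ {A : Set} {n} (f : Fin n → List A) →
                         length (concat (tabulate f)) ≡ ∑[ x < n ] length (f x)
length-concat-tabulate {n = zero}  f = refl
length-concat-tabulate {n = suc n} f =
  trans (length-++ (f zero)) (cong (length (f zero) +_) (length-concat-tabulate (f ∘ suc)))

AllPairs-concat-tabulate : ∀ {A : Set} {R : A → A → Set} {n} (f : Fin n → List A) →
                           (∀ x → AllPairs R (f x)) →
                           (∀ {x y a b} → x Fin.< y → a ∈ f x → b ∈ f y → R a b) →
                           AllPairs R (concat (tabulate f))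
AllPairs-concat-tabulate {n = zero}  f _      _      = []
AllPairs-concat-tabulate {n = suc n} f within across =
  AllPairs.++⁺ (within zero)
    (AllPairs-concat-tabulate (f ∘ suc) (within ∘ suc) (λ {x} {y} x<y → across {suc x} {suc y} (s≤s x<y)))
    (All.tabulate λ a∈ → All.tabulate λ b∈ →
      let y , b∈′ = ∈-concat-tabulate⁻ (f ∘ suc) b∈ in across {zero} {suc y} z<s a∈ b∈′)

-- Lexicographic codes

module LexicographicCode {r s : ℕ} (π : Fin 3 → Fin r → Fin s) where

  letter : Fin r → Triple
  letter x = triple λ i → toℕ (π i x)

  projectedBranchCount : ℕ → Vec ℕ r → Fin 3 → Fin s → ℕ
  projectedBranchCount K e i = branchCount K (pushforward (π i) e)

  offset : ℕ → Vec ℕ r → Fin r → Triple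
  offset K e x = triple λ i → prefixSum (projectedBranchCount K e i) (π i x)

  coord-offset⊕ : ∀ K e x t i → coord i (offset K e x ⊕ t) ≡ prefixSum (projectedBranchCount K e i) (π i x) + coord i t
  coord-offset⊕ K e x t i =
    trans (coord-⊕ i (offset K e x) t)
          (cong (_+ coord i t) (coord-triple (λ j → prefixSum (projectedBranchCount K e j) (π j x)) i))

  -- code K e runs through the words w of length K with letter multiplicities e, in lexicographic order,
  -- and lists for each the triple whose i-th entry is the lexicographic rank of π i w among the words
  -- with the letter multiplicities of π i w.
  -- Opaque for the same reason as multinomial.
  opaque
    code : ℕ → Vec ℕ r → List Triple
    code zero    e = (0 , 0 , 0) ∷ []
    code (suc K) e = concat (tabulate λ x →
      ifNonZero lookup e x then map (offset K e x ⊕_) (code K (decrementAt e x)) else [])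

  opaque
    unfolding code

    block : ℕ → Vec ℕ r → Fin r → List Triple
    block K e x = ifNonZero lookup e x then map (offset K e x ⊕_) (code K (decrementAt e x)) else []

    ∈-block⁻ : ∀ K e x {a} → a ∈ block K e x →
               0 < lookup e x × ∃[ t ] t ∈ code K (decrementAt e x) × a ≡ offset K e x ⊕ t
    ∈-block⁻ K e x a∈ with lookup e x
    ... | suc _ with ∈-map⁻ (offset K e x ⊕_) a∈
    ...   | t , t∈ , a≡ = z<s , t , t∈ , a≡

    length-code : ∀ K e → length (code K e) ≡ multinomial K e
    length-code zero    e = sym (multinomial-zero e)
    length-code (suc K) e =
      trans (length-concat-tabulate (block K e)) (trans (sum-cong-≗ length-block) (sym (multinomial-suc K e)))
      where
        length-block : ∀ x → length (block K e x) ≡ branchCount K e x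
        length-block x with lookup e x
        ... | zero  = refl
        ... | suc _ = trans (length-map _ (code K (decrementAt e x))) (length-code K (decrementAt e x))

    mutual
      code-Below : ∀ K e {t} → t ∈ code K e → ∀ i → coord i t < multinomial K (pushforward (π i) e)
      code-Below zero    e (here refl) i =
        subst₂ _<_ (sym (coord-triple (λ _ → 0) i)) (sym (multinomial-zero (pushforward (π i) e))) z<s
      code-Below (suc K) e t∈ i with ∈-concat-tabulate⁻ (block K e) t∈
      ... | x , t∈block = <-≤-trans (block-coord-< K e x t∈block i)
        (≤-trans (prefixSum-+-≤-∑ (projectedBranchCount K e i) (π i x))
                 (≤-reflexive (sym (multinomial-suc K (pushforward (π i) e)))))

      block-coord-< : ∀ K e x {a} → a ∈ block K e x → ∀ i →
                      coord i a < prefixSum (projectedBranchCount K e i) (π i x) + projectedBranchCount K e i (π i x)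
      block-coord-< K e x a∈ i with ∈-block⁻ K e x a∈
      ... | 0<e[x] , t , t∈ , refl = begin-strict
        coord i (offset K e x ⊕ t)                                ≡⟨ coord-offset⊕ K e x t i ⟩
        p + coord i t                                             <⟨ +-monoʳ-< p (code-Below K (decrementAt e x) t∈ i) ⟩
        p + multinomial K (pushforward (π i) (decrementAt e x))   ≡⟨ cong (p +_) (branchCount-pushforward K (π i) e x 0<e[x]) ⟨
        p + projectedBranchCount K e i (π i x)                               ∎
        where
          open ≤-Reasoning
          p : ℕ
          p = prefixSum (projectedBranchCount K e i) (π i x)

    block-coord-≥ : ∀ K e x {a} → a ∈ block K e x → ∀ i →
                    prefixSum (projectedBranchCount K e i) (π i x) ≤ coord i a
    block-coord-≥ K e x a∈ i with ∈-block⁻ K e x a∈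
    ... | _ , t , _ , refl = subst (_ ≤_) (sym (coord-offset⊕ K e x t i)) (m≤m+n _ (coord i t))

    letter-<⇒block-< : ∀ K e {x y a b} i → coord i (letter x) < coord i (letter y) →
                       a ∈ block K e x → b ∈ block K e y → coord i a < coord i b
    letter-<⇒block-< K e {x} {y} i x<y a∈ b∈ = <-≤-trans (block-coord-< K e x a∈ i)
      (≤-trans (prefixSum-+-≤ (projectedBranchCount K e i) πx<πy) (block-coord-≥ K e y b∈ i))
      where
        πx<πy : π i x Fin.< π i y
        πx<πy = subst₂ _<_ (coord-triple (λ j → toℕ (π j x)) i) (coord-triple (λ j → toℕ (π j y)) i) x<y

    code-2-comparable : (∀ {x y} → x Fin.< y → 2-comparable (letter x) (letter y)) →
                        ∀ K e → AllPairs 2-comparable (code K e)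
    code-2-comparable letters~ zero    e = [] ∷ []
    code-2-comparable letters~ (suc K) e = AllPairs-concat-tabulate (block K e) within across
      where
        within : ∀ x → AllPairs 2-comparable (block K e x)
        within x with lookup e x
        ... | zero  = []
        ... | suc _ = AllPairs.map⁺ (AllPairs.map (⊕-2-comparable (offset K e x))
                                                  (code-2-comparable letters~ K (decrementAt e x)))
        across : ∀ {x y a b} → x Fin.< y → a ∈ block K e x → b ∈ block K e y → 2-comparable a b
        across x<y a∈ b∈ = 2-comparable-transfer
          (λ i x<ᵢy → letter-<⇒block-< K e i x<ᵢy a∈ b∈)
          (λ i y<ᵢx → letter-<⇒block-< K e i y<ᵢx b∈ a∈)
          (letters~ x<y)

n<m^n : ∀ n {m} → 2 ≤ m → n < m ^ n
n<m^n zero    _ = z<s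
n<m^n (suc n) {m@(suc (suc _))} 2≤m@(s≤s (s≤s _)) = begin-strict
  suc n         ≡⟨ +-comm 1 n ⟩
  n + 1         <⟨ +-mono-<-≤ (n<m^n n 2≤m) (m^n>0 m n) ⟩
  m ^ n + m ^ n ≡⟨ cong (m ^ n +_) (+-identityʳ (m ^ n)) ⟨
  2 * m ^ n     ≤⟨ *-monoˡ-≤ (m ^ n) 2≤m ⟩
  m * m ^ n     ∎
  where open ≤-Reasoning

^-≤-^-from-2^-bounds : ∀ {n m} α β p q → n ≤ 2 ^ α → 2 ^ β ≤ m → α * p ≤ β * q → n ^ p ≤ m ^ q
^-≤-^-from-2^-bounds {n} {m} α β p q n≤2^α 2^β≤m αp≤βq = begin
  n ^ p         ≤⟨ ^-monoˡ-≤ p n≤2^α ⟩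
  (2 ^ α) ^ p   ≡⟨ ^-*-assoc 2 α p ⟩
  2 ^ (α * p)   ≤⟨ ^-monoʳ-≤ 2 αp≤βq ⟩
  2 ^ (β * q)   ≡⟨ ^-*-assoc 2 β q ⟨
  (2 ^ β) ^ q   ≤⟨ ^-monoˡ-≤ q 2^β≤m ⟩
  m ^ q         ∎
  where open ≤-Reasoning

^-≤-^-raise : ∀ {a b} p q j → a ^ p ≤ b ^ q → (a ^ j) ^ p ≤ (b ^ j) ^ q
^-≤-^-raise {a} {b} p q j aᵖ≤bᵠ = begin
  (a ^ j) ^ p ≡⟨ ^-*-assoc a j p ⟩
  a ^ (j * p) ≡⟨ cong (a ^_) (*-comm j p) ⟩
  a ^ (p * j) ≡⟨ ^-*-assoc a p j ⟨
  (a ^ p) ^ j ≤⟨ ^-monoˡ-≤ j aᵖ≤bᵠ ⟩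
  (b ^ q) ^ j ≡⟨ ^-*-assoc b q j ⟩
  b ^ (q * j) ≡⟨ cong (b ^_) (*-comm q j) ⟩
  b ^ (j * q) ≡⟨ ^-*-assoc b j q ⟨
  (b ^ j) ^ q ∎
  where open ≤-Reasoning

-- The seed

alphabet : Vec (Vec (Fin 3) 3) 5
alphabet = (# 2 ∷ # 2 ∷ # 2 ∷ []) ∷ (# 0 ∷ # 0 ∷ # 0 ∷ []) ∷ (# 2 ∷ # 1 ∷ # 0 ∷ [])
         ∷ (# 1 ∷ # 0 ∷ # 2 ∷ []) ∷ (# 0 ∷ # 2 ∷ # 1 ∷ []) ∷ []

π : Fin 3 → Fin 5 → Fin 3
π i x = lookup (lookup alphabet x) i

open LexicographicCode π

alphabet-2-comparable : ∀ {x y} → x Fin.< y → 2-comparable (letter x) (letter y)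
alphabet-2-comparable {x} {y} = toWitness {a? = Fin.all? λ x → Fin.all? λ y →
  (x Fin.<? y) →-dec 2-comparable? (letter x) (letter y)} tt x y

K₀ : ℕ
K₀ = 25996

-- Both |S₀| and n₀ grow like the exponential of K₀ times the entropy of the letter frequencies;
-- those of e₀ and t₀ have entropy ratio about 1.5464.
e₀ : Vec ℕ 5
e₀ = 6815 ∷ 6815 ∷ 4122 ∷ 4122 ∷ 4122 ∷ []

t₀ : Vec ℕ 3
t₀ = 10937 ∷ 4122 ∷ 10937 ∷ []

pushforward-e₀ : ∀ i → pushforward (π i) e₀ ≡ t₀
pushforward-e₀ zero             = refl
pushforward-e₀ (suc zero)       = refl
pushforward-e₀ (suc (suc zero)) = refl

n₀ : ℕ
n₀ = multinomial K₀ t₀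

S₀ : List Triple
S₀ = code K₀ e₀

S₀-Below : All (Below n₀) S₀
S₀-Below = All.tabulate λ t∈ i →
  subst (λ c → coord i _ < multinomial K₀ c) (pushforward-e₀ i) (code-Below K₀ e₀ t∈ i)

n₀≤2^38260 : n₀ ≤ 2 ^ 38260
n₀≤2^38260 = subst (_≤ 2 ^ 38260) (sym (multinomial≡!/∏! K₀ t₀ refl)) (≤ᵇ⇒≤ _ _ tt)

2^59152≤|S₀| : 2 ^ 59152 ≤ length S₀
2^59152≤|S₀| =
  subst (2 ^ 59152 ≤_) (sym (trans (length-code K₀ e₀) (multinomial≡!/∏! K₀ e₀ refl))) (≤ᵇ⇒≤ _ _ tt)

2≤n₀ : 2 ≤ n₀
2≤n₀ = subst (2 ≤_) (sym (multinomial≡!/∏! K₀ t₀ refl)) (≤ᵇ⇒≤ _ _ tt)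

S₀-exponent : n₀ ^ 1546 ≤ length S₀ ^ 1000
S₀-exponent = ^-≤-^-from-2^-bounds 38260 59152 1546 1000 n₀≤2^38260 2^59152≤|S₀| (≤ᵇ⇒≤ _ _ tt)

Below⇒TripleIn : ∀ {n t} → Below n t → TripleIn[ n ] ((1 , 1 , 1) ⊕ t)
Below⇒TripleIn t<n = (s≤s z≤n , t<n zero) , (s≤s z≤n , t<n (suc zero)) , (s≤s z≤n , t<n (suc (suc zero)))

theorem1p14 : (N : ℕ) → 1 ≤ N →
    Σ ℕ (λ n → N ≤ n × Σ (List Triple) (λ S →
    Unique S × All TripleIn[ n ] S × 2-comparableSet S ×
    n ^ 1546 ≤ length S ^ 1000))
theorem1p14 N _ =
  n₀ ^ N , <⇒≤ (n<m^n N 2≤n₀) , S ,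
  AllPairs.map 2-comparable⇒≢ S~ ,
  All.map⁺ (All.map Below⇒TripleIn (tensorPower-Below n₀ S₀ N S₀-Below)) ,
  AllPairs⇒2-comparableSet S~ ,
  subst (λ ℓ → (n₀ ^ N) ^ 1546 ≤ ℓ ^ 1000) (sym |S|≡) (^-≤-^-raise 1546 1000 N S₀-exponent)
  where
    S : List Triple
    S = map ((1 , 1 , 1) ⊕_) (tensorPower n₀ S₀ N)
    S~ : AllPairs 2-comparable S
    S~ = AllPairs.map⁺ (AllPairs.map (⊕-2-comparable (1 , 1 , 1))
           (tensorPower-2-comparable n₀ S₀ N S₀-Below (code-2-comparable alphabet-2-comparable K₀ e₀)))
    |S|≡ : length S ≡ length S₀ ^ N
    |S|≡ = trans (length-map _ (tensorPower n₀ S₀ N)) (length-tensorPower n₀ S₀ N)
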